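{- For every integer $m\geq 0$: (1) $\|2^m\cdot 6^r\|_2=m+3r$ for $1\leq r\leq 7$, and $m+3r-1\leq\|2^m\cdot 6^r\|_2\leq m+3r$ for $8\leq r\leq 9$; (2) $\|2^m\cdot 10^r\|_2=m+4r$ for $1\leq r\leq 4$, and $m+19\leq\|2^m\cdot 10^5\|_2\leq m+20$.
   Context: For a positive integer $l$ and $n\in l\mathbb{Z}^+$, the $l$-complexity $\|n\|_l$ is the minimal number of copies of $l$ needed to express $n$ from $l$ using only addition and multiplication (and parentheses). Equivalently, $\|l\|_l=1$ and $\|n\|_l=\min(\|a\|_l+\|b\|_l)$, the minimum over $a,b\in l\mathbb{Z}^+$ with $a+b=n$ or $ab=n$. Here $l=2$. -}

module Defs where

open import Data.Nat using (ℕ; _+_; _*_; _≤_)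
open import Data.Product using (Σ; _×_)
open import Relation.Binary.PropositionalEquality using (_≡_)

data Expr : Set where
  lit  : Expr
  _⊕_  : Expr → Expr → Expr
  _⊗_  : Expr → Expr → Expr

eval : ℕ → Expr → ℕ
eval l lit     = l
eval l (a ⊕ b) = eval l a + eval l b
eval l (a ⊗ b) = eval l a * eval l b

leaves : Expr → ℕ
leaves lit     = 1
leaves (a ⊕ b) = leaves a + leaves b
leaves (a ⊗ b) = leaves a + leaves b

-- ‖n‖_l ≤ k : n can be written with at most k copies of l
ComplexityAtMost : ℕ → ℕ → ℕ → Set
ComplexityAtMost l n k = Σ Expr (λ e → eval l e ≡ n × leaves e ≤ k)

ComplexityAtLeast : ℕ → ℕ → ℕ → Set
ComplexityAtLeast l n k = (e : Expr) → eval l e ≡ n → k ≤ leaves e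

IsComplexity : ℕ → ℕ → ℕ → Set
IsComplexity l n k = ComplexityAtMost l n k × ComplexityAtLeast l n k

{-# OPTIONS --safe #-}
-- Since 6^r = 2^r·3^r and 10^r = 2^r·5^r, the lower bounds have the form ‖2^i·p^j‖₂ ≥ i + F j with
-- p = 3, 5 and F j = 2j − ⌊j/8⌋ resp. 3j − ⌊j/5⌋, subadditive on the range used.  An expression with k
-- copies of 2 has value at most 2^k, which settles every j with 2^(F j) < 2·p^j.  Otherwise induct on
-- the expression.  Its value is even, so i ≥ 1; for i = 1 a verified search over the last few
-- operations decides the bound.  A product splits the powers of 2 and p between its factors, so
-- subadditivity of F suffices.  A sum with i ≥ 2 has value ≡ 0 (mod 4): either a summand 4 or 6
-- splits off, or both summands are at least 8 (and then 4(a + b) ≤ ab), or a summand 2 splits off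
-- and leaves a value ≡ 2 (mod 4), which must again be such a sum; in each case what remains is too
-- large for the leaves left over.  The upper bounds come from 6 = 2 + 2 + 2 and 10 = 2·2·2 + 2.
module Submission where

open import Data.Bool using (Bool; true; false; _∧_; _∨_; not; T; if_then_else_)
open import Data.Bool.Properties using (T-∧; T-∨)
open import Data.Fin using (Fin; toℕ; fromℕ<)
open import Data.Fin.Properties using (all?; toℕ-fromℕ<)
open import Data.Nat using (ℕ; zero; suc; _+_; _*_; _∸_; _^_; _≤_; _<_; z≤n; s≤s; _≤ᵇ_; _<ᵇ_; _≡ᵇ_;
  _%_; _/_; NonZero; >-nonZero)
open import Data.Nat.Divisibility
  using (_∣_; _∣?_; divides; divides-refl; ∣m+n∣m⇒∣n; ∣⇒≤; ∣1⇒≡1; n∣m⇒m%n≡0)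
open import Data.Nat.DivMod using (m*n/n≡m; m<n⇒m/n≡0; m/n≡1+[m∸n]/n)
open import Data.Nat.Primality using (Prime; prime?; euclidsLemma; prime[2]; ¬prime[1]; prime⇒nonZero)
open import Data.Nat.Properties
open import Data.Nat.Tactic.RingSolver using (solve-∀)
open import Data.Product using (_×_; _,_; proj₁; proj₂; uncurry)
open import Data.Sum using (inj₁; inj₂; [_,_]′)
open import Function.Bundles using (Equivalence)
open import Relation.Binary.PropositionalEquality hiding ([_])
open import Relation.Nullary using (¬_; Dec; contradiction)
open import Relation.Nullary.Decidable using (True; toWitness; toWitnessFalse; T?; _→-dec_)

open import Defs

open import Algebra.Properties.CommutativeSemigroup +-commutativeSemigroup
  using () renaming (interchange to +-interchange; x∙yz≈y∙xz to +-left-comm)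
open import Algebra.Properties.CommutativeSemigroup *-commutativeSemigroup
  using () renaming (x∙yz≈y∙xz to *-left-comm)

open Equivalence using (to)

m+n≤m*n : ∀ {m n} → 2 ≤ m → 2 ≤ n → m + n ≤ m * n
m+n≤m*n 2≤m 2≤n with m≤n⇒∃[o]m+o≡n 2≤m | m≤n⇒∃[o]m+o≡n 2≤n
... | x , refl | y , refl = subst (2 + x + (2 + y) ≤_) (sym (expand x y)) (m≤m+n _ _)
  where
  expand : ∀ x y → (2 + x) * (2 + y) ≡ 2 + x + (2 + y) + (x + y + x * y)
  expand = solve-∀

2[m+n]≤4+m*n : ∀ {m n} → 2 ≤ m → 2 ≤ n → 2 * (m + n) ≤ 4 + m * n
2[m+n]≤4+m*n 2≤m 2≤n with m≤n⇒∃[o]m+o≡n 2≤m | m≤n⇒∃[o]m+o≡n 2≤n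
... | x , refl | y , refl = subst (2 * (2 + x + (2 + y)) ≤_) (sym (expand x y)) (m≤m+n _ _)
  where
  expand : ∀ x y → 4 + (2 + x) * (2 + y) ≡ 2 * (2 + x + (2 + y)) + x * y
  expand = solve-∀

4[m+n]≤m*n : ∀ {m n} → 8 ≤ m → 8 ≤ n → 4 * (m + n) ≤ m * n
4[m+n]≤m*n 8≤m 8≤n with m≤n⇒∃[o]m+o≡n 8≤m | m≤n⇒∃[o]m+o≡n 8≤n
... | x , refl | y , refl = subst (4 * (8 + x + (8 + y)) ≤_) (sym (expand x y)) (m≤m+n _ _)
  where
  expand : ∀ x y → (8 + x) * (8 + y) ≡ 4 * (8 + x + (8 + y)) + (4 * x + 4 * y + x * y)
  expand = solve-∀

exponent-≤ : ∀ {t y k} → 2 ^ t < 2 * y → y ≤ 2 ^ k → t ≤ k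
exponent-≤ 2^t<2y y≤2^k = ≮⇒≥ λ k<t →
  <⇒≱ 2^t<2y (≤-trans (*-monoʳ-≤ 2 y≤2^k) (^-monoʳ-≤ 2 k<t))

m+n≡o⇒m≡o∸n : ∀ {m n o} → m + n ≡ o → m ≡ o ∸ n
m+n≡o⇒m≡o∸n {m} {n} refl = sym (m+n∸n≡m m n)

≤-via-∸ : ∀ {t c x k} → t ∸ c ≤ x → c + x ≤ k → t ≤ k
≤-via-∸ {t} {c} t∸c≤x c+x≤k = ≤-trans (m≤n+m∸n t c) (≤-trans (+-monoʳ-≤ c t∸c≤x) c+x≤k)

≤-shift : ∀ {I F x c k} → I + F ≤ x → c + x ≤ k → I + (c + F) ≤ k
≤-shift {I} {F} {x} {c} I+F≤x c+x≤k =
  ≤-trans (≤-reflexive (+-left-comm I c F)) (≤-trans (+-monoʳ-≤ c I+F≤x) c+x≤k)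

m*n*o≡n*o*m : ∀ m n o → m * n * o ≡ n * o * m
m*n*o≡n*o*m = solve-∀

[m*n]^o≡m^o*n^o : ∀ m n o → (m * n) ^ o ≡ m ^ o * n ^ o
[m*n]^o≡m^o*n^o m n zero    = refl
[m*n]^o≡m^o*n^o m n (suc o) =
  trans (cong (m * n *_) ([m*n]^o≡m^o*n^o m n o)) ([m*n]*[o*p]≡[m*o]*[n*p] m n (m ^ o) (n ^ o))

prime∤⇒∤^ : ∀ {q p} → Prime q → ¬ q ∣ p → ∀ j → ¬ q ∣ p ^ j
prime∤⇒∤^ pq q∤p zero    q∣1 = ¬prime[1] (subst Prime (∣1⇒≡1 q∣1) pq)
prime∤⇒∤^ {p = p} pq q∤p (suc j) q∣p^[1+j] with euclidsLemma p (p ^ j) pq q∣p^[1+j]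
... | inj₁ q∣p   = q∤p q∣p
... | inj₂ q∣p^j = prime∤⇒∤^ pq q∤p j q∣p^j

T-not-∨ : ∀ {x y} → T (not x ∨ y) → T x → T y
T-not-∨ {true} y _ = y

half : Expr → ℕ
half lit     = 1
half (a ⊕ b) = half a + half b
half (a ⊗ b) = 2 * (half a * half b)

eval≡2*half : ∀ e → eval 2 e ≡ 2 * half e
eval≡2*half lit     = refl
eval≡2*half (a ⊕ b) = begin
  eval 2 a + eval 2 b         ≡⟨ cong₂ _+_ (eval≡2*half a) (eval≡2*half b) ⟩
  2 * half a + 2 * half b     ≡⟨ *-distribˡ-+ 2 (half a) (half b) ⟨
  2 * (half a + half b)       ∎
  where open ≡-Reasoning
eval≡2*half (a ⊗ b) = begin
  eval 2 a * eval 2 b         ≡⟨ cong₂ _*_ (eval≡2*half a) (eval≡2*half b) ⟩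
  2 * half a * (2 * half b)   ≡⟨ regroup (half a) (half b) ⟩
  2 * (2 * (half a * half b)) ∎
  where
  open ≡-Reasoning
  regroup : ∀ x y → 2 * x * (2 * y) ≡ 2 * (2 * (x * y))
  regroup = solve-∀

half-pos : ∀ e → 1 ≤ half e
half-pos lit     = s≤s z≤n
half-pos (a ⊕ b) = ≤-trans (half-pos a) (m≤m+n (half a) (half b))
half-pos (a ⊗ b) = ≤-trans (*-mono-≤ (half-pos a) (half-pos b)) (m≤n*m (half a * half b) 2)

eval-⊗ : ∀ a b → eval 2 (a ⊗ b) ≡ 4 * (half a * half b)
eval-⊗ a b = trans (eval≡2*half (a ⊗ b)) (sym (*-assoc 2 2 (half a * half b)))

4∣eval-⊗ : ∀ a b → 4 ∣ eval 2 (a ⊗ b)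
4∣eval-⊗ a b = divides (half a * half b) (trans (eval-⊗ a b) (*-comm 4 (half a * half b)))

l≤eval : ∀ {l} → 1 ≤ l → ∀ e → l ≤ eval l e
l≤eval l≥1 lit     = ≤-refl
l≤eval l≥1 (a ⊕ b) = ≤-trans (l≤eval l≥1 a) (m≤m+n _ _)
l≤eval {l} l≥1 (a ⊗ b) = ≤-trans (l≤eval l≥1 a)
  (m≤m*n (eval l a) (eval l b) {{>-nonZero (≤-trans l≥1 (l≤eval l≥1 b))}})

eval≤l^leaves : ∀ {l} → 2 ≤ l → ∀ e → eval l e ≤ l ^ leaves e
eval≤l^leaves {l} l≥2 lit = ≤-reflexive (sym (*-identityʳ l))
eval≤l^leaves {l} l≥2 (a ⊕ b) = begin
  eval l a + eval l b           ≤⟨ m+n≤m*n (≤-trans l≥2 (l≤eval l≥1 a)) (≤-trans l≥2 (l≤eval l≥1 b)) ⟩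
  eval l a * eval l b           ≤⟨ *-mono-≤ (eval≤l^leaves l≥2 a) (eval≤l^leaves l≥2 b) ⟩
  l ^ leaves a * l ^ leaves b   ≡⟨ ^-distribˡ-+-* l (leaves a) (leaves b) ⟨
  l ^ (leaves a + leaves b)     ∎
  where
  open ≤-Reasoning
  l≥1 : 1 ≤ l
  l≥1 = ≤-trans (s≤s z≤n) l≥2
eval≤l^leaves {l} l≥2 (a ⊗ b) = begin
  eval l a * eval l b           ≤⟨ *-mono-≤ (eval≤l^leaves l≥2 a) (eval≤l^leaves l≥2 b) ⟩
  l ^ leaves a * l ^ leaves b   ≡⟨ ^-distribˡ-+-* l (leaves a) (leaves b) ⟨
  l ^ (leaves a + leaves b)     ∎
  where open ≤-Reasoning

leaves-≥ : ∀ {t} e → 2 ^ t < 2 * eval 2 e → t ≤ leaves e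
leaves-≥ e lt = exponent-≤ lt (eval≤l^leaves ≤-refl e)

atMost-* : ∀ {l a b j k} → ComplexityAtMost l a j → ComplexityAtMost l b k →
  ComplexityAtMost l (a * b) (j + k)
atMost-* (e , refl , e≤j) (e′ , refl , e′≤k) = e ⊗ e′ , refl , +-mono-≤ e≤j e′≤k

atMost-^ : ∀ {l x k} → ComplexityAtMost l x k → ∀ r → 1 ≤ r → ComplexityAtMost l (x ^ r) (k * r)
atMost-^ {l} {x} {k} c (suc zero) _ =
  subst₂ (ComplexityAtMost l) (sym (*-identityʳ x)) (sym (*-identityʳ k)) c
atMost-^ {l} {x} {k} c (suc (suc r)) _ =
  subst (ComplexityAtMost l _) (sym (*-suc k (suc r))) (atMost-* c (atMost-^ c (suc r) (s≤s z≤n)))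

atMost-l^* : ∀ {l x k} m → ComplexityAtMost l x k → ComplexityAtMost l (l ^ m * x) (m + k)
atMost-l^* {l} {x} {k} zero c = subst (λ n → ComplexityAtMost l n k) (sym (*-identityˡ x)) c
atMost-l^* {l} {x} {k} (suc m) c =
  subst (λ n → ComplexityAtMost l n (suc m + k)) (sym (*-assoc l (l ^ m) x))
    (atMost-* (lit , refl , ≤-refl) (atMost-l^* m c))

ceilLog₂-from : ℕ → ℕ → ℕ → ℕ
ceilLog₂-from n zero    k = k
ceilLog₂-from n (suc f) k = if 2 ^ k <ᵇ n then ceilLog₂-from n f (suc k) else k

ceilLog₂ : ℕ → ℕ
ceilLog₂ n = ceilLog₂-from n n 0

ceilLog₂-from-≤ : ∀ n f {k k′} → k ≤ k′ → n ≤ 2 ^ k′ → ceilLog₂-from n f k ≤ k′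
ceilLog₂-from-≤ n zero    k≤k′ _ = k≤k′
ceilLog₂-from-≤ n (suc f) {k} {k′} k≤k′ n≤2^k′ with 2 ^ k <ᵇ n in lt
... | true  = ceilLog₂-from-≤ n f k<k′ n≤2^k′
  where
  k<k′ : k < k′
  k<k′ = ≰⇒> λ k′≤k → <⇒≱ (<ᵇ⇒< _ _ (subst T (sym lt) _)) (≤-trans n≤2^k′ (^-monoʳ-≤ 2 k′≤k))
... | false = k≤k′

ceilLog₂-≤ : ∀ {n k} → n ≤ 2 ^ k → ceilLog₂ n ≤ k
ceilLog₂-≤ {n} = ceilLog₂-from-≤ n n z≤n

-- A value ≡ 2 (mod 4) other than 2 is a sum a + b with even a, b ≥ 2, and then 2(a + b) − 4 ≤ ab.
logBound : ℕ → ℕ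
logBound n = if (n % 4 ≡ᵇ 2) ∧ (2 <ᵇ n) then ceilLog₂ (2 * n ∸ 4) else ceilLog₂ n

logBound-sound : ∀ e → logBound (eval 2 e) ≤ leaves e
logBound-sound e with (eval 2 e % 4 ≡ᵇ 2) ∧ (2 <ᵇ eval 2 e) in c
... | false = ceilLog₂-≤ (eval≤l^leaves ≤-refl e)
... | true  = ceilLog₂-≤ (sum-like e c)
  where
  2≤eval : ∀ e → 2 ≤ eval 2 e
  2≤eval = l≤eval (s≤s z≤n)
  sum-like : ∀ e → (eval 2 e % 4 ≡ᵇ 2) ∧ (2 <ᵇ eval 2 e) ≡ true → 2 * eval 2 e ∸ 4 ≤ 2 ^ leaves e
  sum-like lit ()
  sum-like (a ⊗ b) c rewrite n∣m⇒m%n≡0 _ 4 (4∣eval-⊗ a b) with () ← c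
  sum-like (a ⊕ b) _ = m≤n+o⇒m∸n≤o _ 4 (begin
    2 * eval 2 (a ⊕ b)    ≤⟨ 2[m+n]≤4+m*n (2≤eval a) (2≤eval b) ⟩
    4 + eval 2 (a ⊗ b)    ≤⟨ +-monoʳ-≤ 4 (eval≤l^leaves ≤-refl (a ⊗ b)) ⟩
    4 + 2 ^ leaves (a ⊕ b) ∎)
    where open ≤-Reasoning

-- If neither summand is 2, 4 or 6, both are at least 8, and then 4(a + b) ≤ ab.
data SumShape (n k : ℕ) : Set where
  plus2  : ∀ e → eval 2 e + 2 ≡ n → 1 + leaves e ≤ k → SumShape n k
  plus4  : ∀ e → eval 2 e + 4 ≡ n → 2 + leaves e ≤ k → SumShape n k
  plus6  : ∀ e → eval 2 e + 6 ≡ n → 3 + leaves e ≤ k → SumShape n k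
  spread : 4 * n ≤ 2 ^ k → SumShape n k

sumShape : ∀ a b → SumShape (eval 2 (a ⊕ b)) (leaves (a ⊕ b))
sumShape a b = shape (half a) (half b) (eval≡2*half a) (eval≡2*half b) (half-pos a) (half-pos b)
  where
  n k : ℕ
  n = eval 2 (a ⊕ b)
  k = leaves (a ⊕ b)

  small : ∀ {c} e → eval 2 e ≡ 2 * c → 2 ^ c < 2 * (2 * c) → c ≤ leaves e
  small e ec lt = leaves-≥ e (subst (λ v → _ < 2 * v) (sym ec) lt)

  left : ∀ {c} → eval 2 a ≡ 2 * c → 2 ^ c < 2 * (2 * c) → eval 2 b + 2 * c ≡ n × c + leaves b ≤ k
  left {c} ea lt = trans (+-comm (eval 2 b) (2 * c)) (cong (_+ eval 2 b) (sym ea))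
                 , +-monoˡ-≤ (leaves b) (small a ea lt)

  right : ∀ {c} → eval 2 b ≡ 2 * c → 2 ^ c < 2 * (2 * c) → eval 2 a + 2 * c ≡ n × c + leaves a ≤ k
  right {c} eb lt = cong (eval 2 a +_) (sym eb)
                  , ≤-trans (+-monoˡ-≤ (leaves a) (small b eb lt))
                            (≤-reflexive (+-comm (leaves b) (leaves a)))

  8≤ : ∀ {x} e → eval 2 e ≡ 2 * (4 + x) → 8 ≤ eval 2 e
  8≤ {x} e ex = subst (8 ≤_) (sym ex) (*-monoʳ-≤ 2 (m≤m+n 4 x))

  shape : ∀ x y → eval 2 a ≡ 2 * x → eval 2 b ≡ 2 * y → 1 ≤ x → 1 ≤ y → SumShape n k
  shape 1 _ ea _ _ _ = uncurry (plus2 b) (left ea (<ᵇ⇒< 2 4 _))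
  shape 2 _ ea _ _ _ = uncurry (plus4 b) (left ea (<ᵇ⇒< 4 8 _))
  shape 3 _ ea _ _ _ = uncurry (plus6 b) (left ea (<ᵇ⇒< 8 12 _))
  shape (suc (suc (suc (suc _)))) 1 _ eb _ _ = uncurry (plus2 a) (right eb (<ᵇ⇒< 2 4 _))
  shape (suc (suc (suc (suc _)))) 2 _ eb _ _ = uncurry (plus4 a) (right eb (<ᵇ⇒< 4 8 _))
  shape (suc (suc (suc (suc _)))) 3 _ eb _ _ = uncurry (plus6 a) (right eb (<ᵇ⇒< 8 12 _))
  shape (suc (suc (suc (suc _)))) (suc (suc (suc (suc _)))) ea eb _ _ = spread (begin
    4 * n           ≤⟨ 4[m+n]≤m*n (8≤ a ea) (8≤ b eb) ⟩
    eval 2 (a ⊗ b)  ≤⟨ eval≤l^leaves ≤-refl (a ⊗ b) ⟩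
    2 ^ k           ∎)
    where open ≤-Reasoning

factorPairsFrom : (ℕ → ℕ → Bool) → ℕ → ℕ → ℕ → Bool
factorPairsFrom P n zero    k = true
factorPairsFrom P n (suc f) k =
  (n <ᵇ 4 * (suc k * suc k)) ∨ ((not (4 * (suc k * v) ≡ᵇ n) ∨ P (suc k) v) ∧ factorPairsFrom P n f (suc k))
  where
  v : ℕ
  v = n / (4 * suc k)

factorPairs : (ℕ → ℕ → Bool) → ℕ → Bool
factorPairs P n = factorPairsFrom P n n 0

factorPairsFrom-sound : ∀ P n f k → T (factorPairsFrom P n f k) →
  ∀ {u v} → k < u → u ≤ k + f → u ≤ v → 4 * (u * v) ≡ n → T (P u v)
factorPairsFrom-sound P n zero k _ k<u u≤k+0 _ _ =
  contradiction (subst (_ ≤_) (+-identityʳ k) u≤k+0) (<⇒≱ k<u)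
factorPairsFrom-sound P n (suc f) k c {u} {v} k<u u≤k+f u≤v n≡4uv
  with n <ᵇ 4 * (suc k * suc k) in exhausted
... | true = contradiction (<ᵇ⇒< _ _ (subst T (sym exhausted) _)) (≤⇒≯ (begin
    4 * (suc k * suc k)  ≤⟨ *-monoʳ-≤ 4 (*-mono-≤ k<u (≤-trans k<u u≤v)) ⟩
    4 * (u * v)          ≡⟨ n≡4uv ⟩
    n                    ∎))
  where open ≤-Reasoning
... | false with m≤n⇒m<n∨m≡n k<u
...   | inj₁ 1+k<u = factorPairsFrom-sound P n f (suc k) (proj₂ (to T-∧ c))
                     1+k<u (subst (u ≤_) (+-suc k f) u≤k+f) u≤v n≡4uv
...   | inj₂ refl = subst (λ w → T (P u w)) v′≡v (T-not-∨ (proj₁ (to T-∧ c)) 4uv′≡ᵇn)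
  where
  v′≡v : n / (4 * u) ≡ v
  v′≡v = trans (cong (_/ (4 * u)) (trans (sym n≡4uv) (regroup u v))) (m*n/n≡m v (4 * u))
    where
    regroup : ∀ u v → 4 * (u * v) ≡ v * (4 * u)
    regroup = solve-∀
  4uv′≡ᵇn : T (4 * (u * (n / (4 * u))) ≡ᵇ n)
  4uv′≡ᵇn = ≡⇒≡ᵇ _ _ (trans (cong (λ w → 4 * (u * w)) v′≡v) n≡4uv)

factorPairs-sound : ∀ P n → T (factorPairs P n) → ∀ {u v} → 1 ≤ u → u ≤ v → 4 * (u * v) ≡ n → T (P u v)
factorPairs-sound P n c {u} {v} 1≤u u≤v n≡4uv = factorPairsFrom-sound P n n 0 c 1≤u u≤n u≤v n≡4uv
  where
  u≤n : u ≤ n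
  u≤n = subst (u ≤_) n≡4uv (≤-trans (m≤m*n u v {{>-nonZero (≤-trans 1≤u u≤v)}}) (m≤n*m (u * v) 4))

searchBound productsBound sumsBound splitBound : ℕ → ℕ → ℕ → Bool

searchBound f n t = (t ≤ᵇ logBound n) ∨ splitBound f n t

splitBound zero    n t = false
splitBound (suc f) n t = sumsBound f n t ∧ productsBound f n t ∧ (not (n ≡ᵇ 2) ∨ (t ≤ᵇ 1))

sumsBound f n t =
  searchBound f (n ∸ 2) (t ∸ 1) ∧ searchBound f (n ∸ 4) (t ∸ 2) ∧ searchBound f (n ∸ 6) (t ∸ 3)
  ∧ (t ≤ᵇ ceilLog₂ (4 * n))

productsBound f n t = factorPairs (λ u v → searchBound f (2 * v) (t ∸ logBound (2 * u))) n

searchBound-sound : ∀ f {n t} → T (searchBound f n t) → ComplexityAtLeast 2 n t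
splitBound-sound  : ∀ f {n t} → T (splitBound f n t) → ComplexityAtLeast 2 n t
sumsBound-sound : ∀ f {n t} → T (sumsBound f n t) → ∀ a b → eval 2 (a ⊕ b) ≡ n → t ≤ leaves (a ⊕ b)
productsBound-sound : ∀ f {n t} → T (productsBound f n t) → ∀ a b → eval 2 (a ⊗ b) ≡ n → t ≤ leaves (a ⊗ b)

searchBound-sound f c e refl with to T-∨ c
... | inj₁ t≤logBound = ≤-trans (≤ᵇ⇒≤ _ _ t≤logBound) (logBound-sound e)
... | inj₂ split      = splitBound-sound f split e refl

splitBound-sound (suc f) {n} {t} c e eq with to (T-∧ {sumsBound f n t}) c
... | sums , c′ with to (T-∧ {productsBound f n t}) c′
... | products , literal = by-shape e eq
  where
  by-shape : ∀ e → eval 2 e ≡ n → t ≤ leaves e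
  by-shape lit     eq = ≤ᵇ⇒≤ t 1 (T-not-∨ literal (≡⇒≡ᵇ n 2 (sym eq)))
  by-shape (a ⊕ b) eq = sumsBound-sound f sums a b eq
  by-shape (a ⊗ b) eq = productsBound-sound f products a b eq

sumsBound-sound f {n} {t} c a b eq with to (T-∧ {searchBound f (n ∸ 2) (t ∸ 1)}) c
... | c₂ , c′ with to (T-∧ {searchBound f (n ∸ 4) (t ∸ 2)}) c′
... | c₄ , c″ with to (T-∧ {searchBound f (n ∸ 6) (t ∸ 3)}) c″
... | c₆ , c-spread with sumShape a b
... | plus2 e q le = ≤-via-∸ (searchBound-sound f c₂ e (m+n≡o⇒m≡o∸n (trans q eq))) le
... | plus4 e q le = ≤-via-∸ (searchBound-sound f c₄ e (m+n≡o⇒m≡o∸n (trans q eq))) le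
... | plus6 e q le = ≤-via-∸ (searchBound-sound f c₆ e (m+n≡o⇒m≡o∸n (trans q eq))) le
... | spread le    = ≤-trans (≤ᵇ⇒≤ _ _ c-spread) (ceilLog₂-≤ (subst (λ v → 4 * v ≤ _) eq le))

productsBound-sound f {t = t} c a b refl = [ a-smaller , b-smaller ]′ (≤-total (half a) (half b))
  where
  ordered : ∀ x y → half x ≤ half y → 4 * (half x * half y) ≡ eval 2 (a ⊗ b) → t ≤ leaves x + leaves y
  ordered x y hx≤hy eq = ≤-via-∸
    (searchBound-sound f (factorPairs-sound _ _ c (half-pos x) hx≤hy eq) y (eval≡2*half y))
    (+-monoˡ-≤ (leaves y) (subst (λ v → logBound v ≤ leaves x) (eval≡2*half x) (logBound-sound x)))
  a-smaller : half a ≤ half b → t ≤ leaves a + leaves b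
  a-smaller ha≤hb = ordered a b ha≤hb (sym (eval-⊗ a b))
  b-smaller : half b ≤ half a → t ≤ leaves a + leaves b
  b-smaller hb≤ha = subst (t ≤_) (+-comm (leaves b) (leaves a))
    (ordered b a hb≤ha (trans (cong (4 *_) (*-comm (half b) (half a))) (sym (eval-⊗ a b))))

-- 8 bounds the total value peeled off a sum in sum-bound (a summand 2, then one of 2, 4 or 6).
Room : ℕ → ℕ → Set
Room g K = 2 ^ g + 8 < 2 * K

room-bound : ∀ {I K s F′ g y k} → 1 ≤ I → s ≤ 8 → F′ ≤ g → Room g K →
  2 ^ I * K ≤ y + s → y ≤ 2 ^ k → I + F′ ≤ k
room-bound {I} {K} {s} {F′} {g} {y} 1≤I s≤8 F′≤g room N≤y+s =
  exponent-≤ (+-cancelʳ-< (2 * s) _ _ (begin-strict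
  2 ^ (I + F′) + 2 * s  ≡⟨ cong (_+ 2 * s) (^-distribˡ-+-* 2 I F′) ⟩
  P * A + 2 * s         ≤⟨ +-monoʳ-≤ (P * A) (*-monoˡ-≤ s (^-monoʳ-≤ 2 1≤I)) ⟩
  P * A + P * s         ≡⟨ *-distribˡ-+ P A s ⟨
  P * (A + s)           <⟨ *-monoʳ-< P {{m^n≢0 2 I}} A+s<2K ⟩
  P * (2 * K)           ≡⟨ *-left-comm P 2 K ⟩
  2 * (P * K)           ≤⟨ *-monoʳ-≤ 2 N≤y+s ⟩
  2 * (y + s)           ≡⟨ *-distribˡ-+ 2 y s ⟩
  2 * y + 2 * s         ∎))
  where
  open ≤-Reasoning
  P A : ℕ
  P = 2 ^ I
  A = 2 ^ F′
  A+s<2K : A + s < 2 * K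
  A+s<2K = ≤-<-trans (+-mono-≤ (^-monoʳ-≤ 2 F′≤g) s≤8) room

room-*4 : ∀ {h K} → Room (2 + h) K → Room (4 + h) (4 * K)
room-*4 {h} {K} room = begin-strict
  2 ^ (4 + h) + 8       ≤⟨ +-monoʳ-≤ (2 ^ (4 + h)) (≤ᵇ⇒≤ 8 32 _) ⟩
  2 ^ (4 + h) + 32      ≡⟨ scale (2 ^ (2 + h)) ⟩
  4 * (2 ^ (2 + h) + 8) <⟨ *-monoʳ-< 4 room ⟩
  4 * (2 * K)           ≡⟨ *-left-comm 4 2 K ⟩
  2 * (4 * K)           ∎
  where
  open ≤-Reasoning
  scale : ∀ x → 2 * (2 * x) + 32 ≡ 4 * (x + 8)
  scale = solve-∀

room⇒4<2^i*K : ∀ {g K} i → Room g K → 4 < 2 ^ i * K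
room⇒4<2^i*K {g} {K} i room = <-≤-trans 4<K (m≤n*m K (2 ^ i) {{m^n≢0 2 i}})
  where
  4<K : 4 < K
  4<K = *-cancelˡ-< 2 4 K (≤-<-trans (m≤n+m 8 (2 ^ g)) room)

sum-bound : ∀ {K h} i → Room (2 + h) K → ∀ a b →
  eval 2 (a ⊕ b) ≡ 2 ^ (2 + i) * K → (2 + i) + (4 + h) ≤ leaves (a ⊕ b)
sum-bound {K} {h} i room a b eq = by-shape (sumShape a b)
  where
  I N : ℕ
  I = 2 + i
  N = 2 ^ I * K

  residual : ∀ {s F′} e → s ≤ 8 → F′ ≤ 2 + h → eval 2 e + s ≡ N → I + F′ ≤ leaves e
  residual e s≤8 F′≤ q =
    room-bound {K = K} (s≤s z≤n) s≤8 F′≤ room (≤-reflexive (sym q)) (eval≤l^leaves ≤-refl e)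

  spread-residual : ∀ {s F′ x k} → s ≤ 2 → F′ ≤ 4 + h → x + s ≡ N → 4 * x ≤ 2 ^ k → I + F′ ≤ k
  spread-residual {s} {x = x} s≤2 F′≤ q =
    room-bound {K = 4 * K} (s≤s z≤n) (*-monoʳ-≤ 4 s≤2) F′≤ (room-*4 {h} {K} room) (≤-reflexive (begin
      2 ^ I * (4 * K)  ≡⟨ *-left-comm (2 ^ I) 4 K ⟩
      4 * N            ≡⟨ cong (4 *_) q ⟨
      4 * (x + s)      ≡⟨ *-distribˡ-+ 4 x s ⟩
      4 * x + 4 * s    ∎))
    where open ≡-Reasoning

  4∣N : 4 ∣ N
  4∣N = divides (2 ^ i * K) (regroup (2 ^ i) K)
    where
    regroup : ∀ x y → 2 * (2 * x) * y ≡ x * y * 4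
    regroup = solve-∀

  two-less : ∀ e → eval 2 e + 2 ≡ N → I + (3 + h) ≤ leaves e
  two-less lit     q = contradiction (≤-reflexive (sym q)) (<⇒≱ (room⇒4<2^i*K {2 + h} I room))
  two-less (u ⊗ w) q = contradiction (∣m+n∣m⇒∣n (subst (4 ∣_) (sym q) 4∣N) (4∣eval-⊗ u w))
    λ 4∣2 → <⇒≱ (≤ᵇ⇒≤ 3 4 _) (∣⇒≤ 4∣2)
  two-less (u ⊕ w) q = by-inner-shape (sumShape u w)
    where
    chain : ∀ {c} e → eval 2 e + c ≡ eval 2 (u ⊕ w) → eval 2 e + (c + 2) ≡ N
    chain {c} e q′ = trans (sym (+-assoc (eval 2 e) c 2)) (trans (cong (_+ 2) q′) q)
    by-inner-shape : SumShape (eval 2 (u ⊕ w)) (leaves (u ⊕ w)) → I + (3 + h) ≤ leaves (u ⊕ w)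
    by-inner-shape (plus2 e q′ le) = ≤-shift {I} {2 + h} (residual e (≤ᵇ⇒≤ 4 8 _) ≤-refl (chain e q′)) le
    by-inner-shape (plus4 e q′ le) = ≤-shift {I} {1 + h} (residual e (≤ᵇ⇒≤ 6 8 _) (n≤1+n _) (chain e q′)) le
    by-inner-shape (plus6 e q′ le) = ≤-shift {I} {h} (residual e ≤-refl (m≤n+m h 2) (chain e q′)) le
    by-inner-shape (spread le)     = spread-residual ≤-refl (n≤1+n _) q le

  by-shape : SumShape (eval 2 (a ⊕ b)) (leaves (a ⊕ b)) → I + (4 + h) ≤ leaves (a ⊕ b)
  by-shape (plus2 e q le) = ≤-shift {I} {3 + h} (two-less e (trans q eq)) le
  by-shape (plus4 e q le) = ≤-shift {I} {2 + h} (residual e (≤ᵇ⇒≤ 4 8 _) ≤-refl (trans q eq)) le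
  by-shape (plus6 e q le) = ≤-shift {I} {1 + h} (residual e (≤ᵇ⇒≤ 6 8 _) (n≤1+n _) (trans q eq)) le
  by-shape (spread le)    = spread-residual z≤n ≤-refl (trans (+-identityʳ _) eq) le

record PowerSplit (q i z x y : ℕ) : Set where
  field
    i₁ i₂ x′ y′ : ℕ
    exponents   : i₁ + i₂ ≡ i
    left        : x ≡ q ^ i₁ * x′
    right       : y ≡ q ^ i₂ * y′
    cofactors   : x′ * y′ ≡ z

split-prime-power : ∀ {q} → Prime q → ∀ i {x y z} → x * y ≡ q ^ i * z → PowerSplit q i z x y
split-prime-power _ zero {x} {y} {z} eq = record
  { i₁ = 0 ; i₂ = 0 ; x′ = x ; y′ = y ; exponents = refl
  ; left = sym (*-identityˡ x) ; right = sym (*-identityˡ y) ; cofactors = trans eq (*-identityˡ z) }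
split-prime-power {q} pq (suc i) {x} {y} {z} eq
  with euclidsLemma x y pq (divides (q ^ i * z) (trans eq (m*n*o≡n*o*m q (q ^ i) z)))
... | inj₁ (divides-refl x₀) = record
  { i₁ = suc i₁ ; i₂ = i₂ ; x′ = x′ ; y′ = y′ ; exponents = cong suc exponents
  ; left = trans (cong (_* q) left) (sym (m*n*o≡n*o*m q (q ^ i₁) x′))
  ; right = right ; cofactors = cofactors }
  where
  swap-inner : ∀ q x y → q * (x * y) ≡ x * q * y
  swap-inner = solve-∀
  open PowerSplit (split-prime-power pq i {x₀} {y} (*-cancelˡ-≡ _ _ q {{prime⇒nonZero pq}}
    (trans (swap-inner q x₀ y) (trans eq (*-assoc q (q ^ i) z)))))
... | inj₂ (divides-refl y₀) = record
  { i₁ = i₁ ; i₂ = suc i₂ ; x′ = x′ ; y′ = y′ ; exponents = trans (+-suc i₁ i₂) (cong suc exponents)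
  ; left = left ; right = trans (cong (_* q) right) (sym (m*n*o≡n*o*m q (q ^ i₂) y′))
  ; cofactors = cofactors }
  where
  swap-outer : ∀ q x y → q * (x * y) ≡ x * (y * q)
  swap-outer = solve-∀
  open PowerSplit (split-prime-power pq i {x} {y₀} (*-cancelˡ-≡ _ _ q {{prime⇒nonZero pq}}
    (trans (swap-outer q x y₀) (trans eq (*-assoc q (q ^ i) z)))))

record Factorisation (p i j x y : ℕ) : Set where
  field
    i₁ i₂ j₁ j₂ : ℕ
    i-split     : i₁ + i₂ ≡ i
    j-split     : j₁ + j₂ ≡ j
    left        : x ≡ 2 ^ i₁ * p ^ j₁
    right       : y ≡ 2 ^ i₂ * p ^ j₂

factorise : ∀ {p} → Prime p → ∀ {i j x y} → x * y ≡ 2 ^ i * p ^ j → Factorisation p i j x y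
factorise {p} pp {i} {j} {x} {y} eq = record
  { i₁ = Two.i₁ ; i₂ = Two.i₂ ; j₁ = Odd.i₁ ; j₂ = Odd.i₂
  ; i-split = Two.exponents ; j-split = Odd.exponents
  ; left    = trans Two.left  (cong (2 ^ Two.i₁ *_) (drop-unit Odd.left  (m*n≡1⇒m≡1 Odd.x′ Odd.y′ Odd.cofactors)))
  ; right   = trans Two.right (cong (2 ^ Two.i₂ *_) (drop-unit Odd.right (m*n≡1⇒n≡1 Odd.x′ Odd.y′ Odd.cofactors)))
  }
  where
  module Two = PowerSplit (split-prime-power prime[2] i {x} {y} eq)
  module Odd = PowerSplit
    (split-prime-power pp j {Two.x′} {Two.y′} (trans Two.cofactors (sym (*-identityʳ (p ^ j)))))
  drop-unit : ∀ {a b c} → a ≡ b * c → c ≡ 1 → a ≡ b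
  drop-unit {b = b} a≡bc refl = trans a≡bc (*-identityʳ b)

-- Either the size bound alone gives ‖2^i·p^j‖₂ ≥ i + F j, or the two cases of the induction
-- that do not recurse are covered: sums with i ≥ 2 (via Room) and i = 1 (by search).
data Certificate (p : ℕ) (F : ℕ → ℕ) (j : ℕ) : Set where
  by-size   : 2 ^ F j < 2 * p ^ j → Certificate p F j
  by-search : ∀ h → F j ≡ 4 + h → Room (2 + h) (p ^ j) →
              ComplexityAtLeast 2 (2 * p ^ j) (1 + F j) → Certificate p F j

SubadditiveUpTo : (ℕ → ℕ) → ℕ → Set
SubadditiveUpTo F J = ∀ a b → a + b ≤ J → F (a + b) ≤ F a + F b

module ProfileBound {p} (prime : Prime p) (odd : ¬ 2 ∣ p) {F : ℕ → ℕ} {J : ℕ}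
  (subadditive : SubadditiveUpTo F J)
  (certificate : ∀ j → j ≤ J → Certificate p F j) where

  profile-bound  : ∀ e i j → j ≤ J → eval 2 e ≡ 2 ^ i * p ^ j → i + F j ≤ leaves e
  searched-bound : ∀ e i j h → j ≤ J → F j ≡ 4 + h → Room (2 + h) (p ^ j) →
    ComplexityAtLeast 2 (2 * p ^ j) (1 + F j) → eval 2 e ≡ 2 ^ i * p ^ j → i + F j ≤ leaves e
  product-bound  : ∀ a b i j → j ≤ J → eval 2 (a ⊗ b) ≡ 2 ^ i * p ^ j → i + F j ≤ leaves (a ⊗ b)

  profile-bound e i j j≤J eq with certificate j j≤J
  ... | by-search h Fj≡ room search = searched-bound e i j h j≤J Fj≡ room search eq
  ... | by-size small = leaves-≥ e (begin-strict
    2 ^ (i + F j)        ≡⟨ ^-distribˡ-+-* 2 i (F j) ⟩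
    2 ^ i * 2 ^ F j      <⟨ *-monoʳ-< (2 ^ i) {{m^n≢0 2 i}} small ⟩
    2 ^ i * (2 * p ^ j)  ≡⟨ *-left-comm (2 ^ i) 2 (p ^ j) ⟩
    2 * (2 ^ i * p ^ j)  ≡⟨ cong (2 *_) eq ⟨
    2 * eval 2 e         ∎)
    where open ≤-Reasoning

  searched-bound (a ⊗ b) i j h j≤J _ _ _ eq = product-bound a b i j j≤J eq
  searched-bound e 0 j h _ _ _ _ eq = contradiction 2∣p^j (prime∤⇒∤^ prime[2] odd j)
    where
    2∣p^j : 2 ∣ p ^ j
    2∣p^j = divides (half e) (begin
      p ^ j          ≡⟨ trans eq (*-identityˡ (p ^ j)) ⟨
      eval 2 e       ≡⟨ eval≡2*half e ⟩
      2 * half e     ≡⟨ *-comm 2 (half e) ⟩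
      half e * 2     ∎)
      where open ≡-Reasoning
  searched-bound e 1 j h _ _ _ search eq = search e eq
  searched-bound lit (suc (suc i)) j h _ _ room _ eq =
    contradiction (≤-trans (≤-reflexive (sym eq)) (≤ᵇ⇒≤ 2 4 _))
                  (<⇒≱ (room⇒4<2^i*K {2 + h} (2 + i) room))
  searched-bound (a ⊕ b) (suc (suc i)) j h _ Fj≡ room _ eq =
    subst (λ v → 2 + i + v ≤ leaves (a ⊕ b)) (sym Fj≡) (sum-bound i room a b eq)

  product-bound a b i j j≤J eq = begin
    i + F j                      ≡⟨ cong₂ (λ i j → i + F j) (sym i-split) (sym j-split) ⟩
    (i₁ + i₂) + F (j₁ + j₂)      ≤⟨ +-monoʳ-≤ (i₁ + i₂) (subadditive j₁ j₂ j₁+j₂≤J) ⟩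
    (i₁ + i₂) + (F j₁ + F j₂)    ≡⟨ +-interchange i₁ i₂ (F j₁) (F j₂) ⟩
    (i₁ + F j₁) + (i₂ + F j₂)    ≤⟨ +-mono-≤ (profile-bound a i₁ j₁ j₁≤J left)
                                            (profile-bound b i₂ j₂ j₂≤J right) ⟩
    leaves a + leaves b          ∎
    where
    open ≤-Reasoning
    open Factorisation (factorise prime {i} {j} {eval 2 a} {eval 2 b} eq)
    j₁+j₂≤J : j₁ + j₂ ≤ J
    j₁+j₂≤J = subst (_≤ J) (sym j-split) j≤J
    j₁≤J : j₁ ≤ J
    j₁≤J = ≤-trans (m≤m+n j₁ j₂) j₁+j₂≤J
    j₂≤J : j₂ ≤ J
    j₂≤J = ≤-trans (m≤n+m j₂ j₁) j₁+j₂≤J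

  scaled-bound : ∀ m r → r ≤ J → ComplexityAtLeast 2 (2 ^ m * (2 * p) ^ r) (m + r + F r)
  scaled-bound m r r≤J e eq = profile-bound e (m + r) r r≤J (begin
    eval 2 e                 ≡⟨ eq ⟩
    2 ^ m * (2 * p) ^ r      ≡⟨ cong (2 ^ m *_) ([m*n]^o≡m^o*n^o 2 p r) ⟩
    2 ^ m * (2 ^ r * p ^ r)  ≡⟨ *-assoc (2 ^ m) (2 ^ r) (p ^ r) ⟨
    2 ^ m * 2 ^ r * p ^ r    ≡⟨ cong (_* p ^ r) (^-distribˡ-+-* 2 m r) ⟨
    2 ^ (m + r) * p ^ r      ∎)
    where open ≡-Reasoning

certify : ℕ → ℕ → (ℕ → ℕ) → ℕ → Bool
certify f p F j = (2 ^ F j <ᵇ 2 * p ^ j)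
  ∨ ((4 ≤ᵇ F j) ∧ (2 ^ (2 + (F j ∸ 4)) + 8 <ᵇ 2 * p ^ j) ∧ searchBound f (2 * p ^ j) (1 + F j))

certify-sound : ∀ f p F j → T (certify f p F j) → Certificate p F j
certify-sound f p F j c with to (T-∨ {2 ^ F j <ᵇ 2 * p ^ j}) c
... | inj₁ small = by-size (<ᵇ⇒< _ _ small)
... | inj₂ c′ with to (T-∧ {4 ≤ᵇ F j}) c′
... | 4≤Fj , c″ with to (T-∧ {2 ^ (2 + (F j ∸ 4)) + 8 <ᵇ 2 * p ^ j}) c″
... | room , search = by-search (F j ∸ 4) (sym (m+[n∸m]≡n (≤ᵇ⇒≤ 4 (F j) 4≤Fj)))
                        (<ᵇ⇒< _ _ room) (searchBound-sound f search)

all-≤ : ∀ {P : ℕ → Set} J → (∀ (j : Fin (suc J)) → P (toℕ j)) → ∀ j → j ≤ J → P j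
all-≤ {P} J all j j≤J = subst P (toℕ-fromℕ< (s≤s j≤J)) (all (fromℕ< (s≤s j≤J)))

certified? : ∀ f p F J → Dec (∀ (j : Fin (suc J)) → T (certify f p F (toℕ j)))
certified? f p F J = all? λ j → T? (certify f p F (toℕ j))

certified : ∀ f p F J → True (certified? f p F J) → ∀ j → j ≤ J → Certificate p F j
certified f p F J ok j j≤J = certify-sound f p F j (all-≤ J (toWitness ok) j j≤J)

subadditive? : ∀ (F : ℕ → ℕ) J →
  Dec (∀ (a b : Fin (suc J)) → toℕ a + toℕ b ≤ J → F (toℕ a + toℕ b) ≤ F (toℕ a) + F (toℕ b))
subadditive? F J = all? λ a → all? λ b →
  (toℕ a + toℕ b ≤? J) →-dec (F (toℕ a + toℕ b) ≤? F (toℕ a) + F (toℕ b))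

subadditive : ∀ F J → True (subadditive? F J) → SubadditiveUpTo F J
subadditive F J ok a b a+b≤J =
  all-≤ {λ b → a + b ≤ J → F (a + b) ≤ F a + F b} J
    (all-≤ {λ a → ∀ (b : Fin (suc J)) → a + toℕ b ≤ J → F (a + toℕ b) ≤ F a + F (toℕ b)} J
      (toWitness ok) a (≤-trans (m≤m+n a b) a+b≤J))
    b (≤-trans (m≤n+m b a) a+b≤J) a+b≤J

profile : ℕ → (d : ℕ) → .{{NonZero d}} → ℕ → ℕ
profile c d j = c * j ∸ j / d

profile-below : ∀ c {d} .{{_ : NonZero d}} {j} → j < d → profile c d j ≡ c * j
profile-below c j<d = cong (c * _ ∸_) (m<n⇒m/n≡0 j<d)

profile-next : ∀ c {d} .{{_ : NonZero d}} {j} → d ≤ j → j < d + d → profile c d j ≡ c * j ∸ 1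
profile-next c {d} {j} d≤j j<d+d =
  cong (c * j ∸_) (trans (m/n≡1+[m∸n]/n d≤j) (cong suc (m<n⇒m/n≡0 j∸d<d)))
  where
  j∸d<d : j ∸ d < d
  j∸d<d = subst (j ∸ d <_) (m+n∸m≡n d d) (∸-monoˡ-< j<d+d d≤j)

linear-profile : ∀ m c {d} .{{_ : NonZero d}} r → r < d → m + r + profile c d r ≡ m + suc c * r
linear-profile m c r r<d = trans (cong (m + r +_) (profile-below c r<d)) (+-assoc m r (c * r))

near-profile : ∀ m c {d} .{{_ : NonZero d}} r → d ≤ r → r < d + d → 1 ≤ c * r →
  m + r + profile c d r ≡ m + suc c * r ∸ 1
near-profile m c {d} r d≤r r<d+d 1≤cr = begin
  m + r + profile c d r  ≡⟨ cong (m + r +_) (profile-next c d≤r r<d+d) ⟩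
  m + r + (c * r ∸ 1)    ≡⟨ +-∸-assoc (m + r) 1≤cr ⟨
  m + r + c * r ∸ 1      ≡⟨ cong (_∸ 1) (+-assoc m r (c * r)) ⟩
  m + suc c * r ∸ 1      ∎
  where open ≡-Reasoning

-- Each underscore below is a proof by evaluation: subadditivity of the profile, and a certificate
-- for every j, found by a search of depth 6.
module Threes = ProfileBound {3} (toWitness {a? = prime? 3} _) (toWitnessFalse {a? = 2 ∣? 3} _)
  {profile 2 8} {9} (subadditive (profile 2 8) 9 _) (certified 6 3 (profile 2 8) 9 _)

module Fives = ProfileBound {5} (toWitness {a? = prime? 5} _) (toWitnessFalse {a? = 2 ∣? 5} _)
  {profile 3 5} {5} (subadditive (profile 3 5) 5 _) (certified 6 5 (profile 3 5) 5 _)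

six : ComplexityAtMost 2 6 3
six = (lit ⊕ lit) ⊕ lit , refl , ≤-refl

ten : ComplexityAtMost 2 10 4
ten = ((lit ⊗ lit) ⊗ lit) ⊕ lit , refl , ≤-refl

theorem1p3 : (m : ℕ) →
    ((r : ℕ) → 1 ≤ r → r ≤ 7 → IsComplexity 2 (2 ^ m * 6 ^ r) (m + 3 * r))
    × ((r : ℕ) → 8 ≤ r → r ≤ 9 →
         ComplexityAtLeast 2 (2 ^ m * 6 ^ r) (m + 3 * r ∸ 1)
         × ComplexityAtMost 2 (2 ^ m * 6 ^ r) (m + 3 * r))
    × ((r : ℕ) → 1 ≤ r → r ≤ 4 → IsComplexity 2 (2 ^ m * 10 ^ r) (m + 4 * r))
    × (ComplexityAtLeast 2 (2 ^ m * 10 ^ 5) (m + 19)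
       × ComplexityAtMost 2 (2 ^ m * 10 ^ 5) (m + 20))
theorem1p3 m =
    (λ r 1≤r r≤7 → upper six r 1≤r
                 , lower (linear-profile m 2 r (s≤s r≤7)) (Threes.scaled-bound m r (≤-trans r≤7 (≤ᵇ⇒≤ 7 9 _))))
  , (λ r 8≤r r≤9 → lower (near-profile m 2 r 8≤r (s≤s (≤-trans r≤9 (≤ᵇ⇒≤ 9 15 _))) (1≤2r 8≤r))
                         (Threes.scaled-bound m r r≤9)
                 , upper six r (≤-trans (s≤s z≤n) 8≤r))
  , (λ r 1≤r r≤4 → upper ten r 1≤r
                 , lower (linear-profile m 3 r (s≤s r≤4)) (Fives.scaled-bound m r (≤-trans r≤4 (≤ᵇ⇒≤ 4 5 _))))
  , lower (+-assoc m 5 14) (Fives.scaled-bound m 5 ≤-refl)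
  , upper ten 5 (s≤s z≤n)
  where
  upper : ∀ {x k} → ComplexityAtMost 2 x k → ∀ r → 1 ≤ r → ComplexityAtMost 2 (2 ^ m * x ^ r) (m + k * r)
  upper c r 1≤r = atMost-l^* m (atMost-^ c r 1≤r)
  lower : ∀ {n k k′} → k ≡ k′ → ComplexityAtLeast 2 n k → ComplexityAtLeast 2 n k′
  lower {n} = subst (ComplexityAtLeast 2 n)
  1≤2r : ∀ {r} → 8 ≤ r → 1 ≤ 2 * r
  1≤2r {r} 8≤r = ≤-trans (s≤s z≤n) (≤-trans 8≤r (m≤m+n r (r + 0)))
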